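{- Let $H$ be a subdivision of $K_4$ that is not bipartite. Then every orientation of $H$ contains an inconsistent odd cycle.
   Context: A subdivision of an undirected graph $K$ is obtained by replacing each edge of $K$ with a path of length at least $1$ (internally disjoint new paths). In an oriented graph, a cycle is called inconsistent if it is a cycle of the underlying undirected graph but is not a directed cycle. An odd cycle is a cycle of odd length. -}

module Defs where

open import Data.Nat using (ℕ; zero; suc; _≤_; _<?_)
open import Data.Nat.DivMod using (_mod_)
open import Data.Fin using (Fin; zero; suc; toℕ; fromℕ<)
open import Data.Bool using (Bool; true; false; if_then_else_)
open import Data.Product using (Σ; _×_; _,_; proj₁; proj₂; ∃)
open import Data.Sum using (_⊎_; inj₁; inj₂)
open import Relation.Binary.PropositionalEquality using (_≡_; _≢_)
open import Relation.Nullary using (¬_; yes; no)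
open import Function.Definitions using (Injective)

-- Finite (multi)graphs given by a vertex type, an edge type and, for each
-- edge, an (arbitrarily ordered) pair of endpoints.

record Graph : Set₁ where
  field
    V    : Set
    E    : Set
    ends : E → V × V
open Graph public

Joins : (G : Graph) → E G → V G → V G → Set
Joins G e u w = (ends G e ≡ (u , w)) ⊎ (ends G e ≡ (w , u))

Bipartite : Graph → Set
Bipartite G = Σ (V G → Bool) λ c → ∀ e → c (proj₁ (ends G e)) ≢ c (proj₂ (ends G e))

-- An orientation: for every edge choose a direction.
-- true  : the edge is directed  proj₁ (ends e) → proj₂ (ends e)
-- false : the edge is directed  proj₂ (ends e) → proj₁ (ends e)
Orientation : Graph → Set
Orientation G = E G → Bool

tail : (G : Graph) → Orientation G → E G → V G
tail G o e = if o e then proj₁ (ends G e) else proj₂ (ends G e)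

head : (G : Graph) → Orientation G → E G → V G
head G o e = if o e then proj₂ (ends G e) else proj₁ (ends G e)

csuc : ∀ {m} → Fin m → Fin m
csuc {suc n} i = suc (toℕ i) mod suc n

record Cycle (G : Graph) : Set where
  field
    len      : ℕ
    len≥3    : 3 ≤ len
    vert     : Fin len → V G
    vert-inj : Injective _≡_ _≡_ vert
    edge     : Fin len → E G
    edge-ok  : ∀ i → Joins G (edge i) (vert i) (vert (csuc i))
open Cycle public

DirectedCycle : (G : Graph) → Orientation G → Cycle G → Set
DirectedCycle G o C =
  (∀ i → tail G o (edge C i) ≡ vert C i) ⊎ (∀ i → head G o (edge C i) ≡ vert C i)

Inconsistent : (G : Graph) → Orientation G → Cycle G → Set
Inconsistent G o C = ¬ DirectedCycle G o C

data Odd : ℕ → Set where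
  one : Odd 1
  ss  : ∀ {n} → Odd n → Odd (suc (suc n))

K4ends : Fin 6 → Fin 4 × Fin 4
K4ends zero                            = (zero , suc zero)
K4ends (suc zero)                      = (zero , suc (suc zero))
K4ends (suc (suc zero))                = (zero , suc (suc (suc zero)))
K4ends (suc (suc (suc zero)))          = (suc zero , suc (suc zero))
K4ends (suc (suc (suc (suc zero))))    = (suc zero , suc (suc (suc zero)))
K4ends (suc (suc (suc (suc (suc zero))))) = (suc (suc zero) , suc (suc (suc zero)))

-- Subdivision of K₄ in which edge e is replaced by a path of length
-- suc (k e) ≥ 1, i.e. with k e new internal vertices.
SubV : (Fin 6 → ℕ) → Set
SubV k = Fin 4 ⊎ Σ (Fin 6) (λ e → Fin (k e))

-- the vertex at position j along the path replacing e
-- (position 0 = first end, 1..k e internal, k e + 1 = second end)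
pathPos : (k : Fin 6 → ℕ) → (e : Fin 6) → ℕ → SubV k
pathPos k e zero = inj₁ (proj₁ (K4ends e))
pathPos k e (suc j) with j <? k e
... | yes p = inj₂ (e , fromℕ< p)
... | no _  = inj₁ (proj₂ (K4ends e))

SubdivK4 : (Fin 6 → ℕ) → Graph
SubdivK4 k = record
  { V    = SubV k
  ; E    = Σ (Fin 6) (λ e → Fin (suc (k e)))
  ; ends = λ { (e , j) → (pathPos k e (toℕ j) , pathPos k e (suc (toℕ j))) }
  }

-- Colouring each vertex by the parity of its distance from branch vertex 0 along the subdividing
-- paths is a proper 2-colouring as soon as the triangles 012, 013 and 023 of K₄ have even
-- subdivided length; so H being non-bipartite, one of them is odd, say the one opposite v.  For
-- each pair of the three paths at v, the triangle through them and the quadrilateral through them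
-- and the third neighbour of v add up, in the cycle space over 𝔽₂, to that odd triangle, so one of
-- the two is an odd cycle.  A directed cycle through v enters v along one path of its pair and
-- leaves along the other, so if all three odd cycles were directed, the three paths at v would be
-- pairwise oppositely oriented with respect to v, which is impossible.

module Submission where

open import Defs
open import Algebra.Bundles using (CommutativeRing)
import Algebra.Properties.CommutativeSemigroup as CommutativeSemigroupProperties
open import Data.Bool using (Bool; true; false; not; _∧_; _xor_; if_then_else_)
open import Data.Bool.Properties
  using (xor-assoc; xor-same; xor-identityʳ; xor-inverseˡ; xor-comm; ∧-distribʳ-xor; not-¬; xor-∧-commutativeRing)
  renaming (_≟_ to _≟ᵇ_)
open import Data.Empty using (⊥; ⊥-elim)
open import Data.Fin using (Fin; zero; suc; toℕ; fromℕ<; inject₁)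
open import Data.Fin.Properties using (toℕ-fromℕ<; toℕ-injective; toℕ<n; toℕ-inject₁; all?)
  renaming (_≟_ to _≟ᶠ_)
open import Data.List using (List; []; _∷_; length)
open import Data.List.Membership.Propositional using (_∈_)
open import Data.List.Relation.Unary.All using (All; []; _∷_; lookup)
open import Data.Nat using (ℕ; zero; suc; _+_; _∸_; _≤_; _<_; s≤s; z≤n; _<?_)
open import Data.Nat.DivMod using (_%_; m<n⇒m%n≡m; n%n≡0)
open import Data.Nat.Properties
  using (suc-injective; ≤-refl; ≤-trans; ≤-antisym; ≤-pred; <⇒≤; ≮⇒≥; <-irrefl; n≤1+n;
         m≤n+m; +-identityʳ; +-suc; +-cancelʳ-≡; m∸n+n≡m)
open import Data.Product using (Σ; _×_; _,_; proj₁; proj₂)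
import Data.Product.Properties as Product
open import Data.Sum using (_⊎_; inj₁; inj₂)
import Data.Sum.Properties as Sum
open import Data.Unit using (⊤; tt)
open import Data.Vec using (Vec; []; _∷_; replicate; zipWith; _[_]%=_)
open import Function using (_∘_)
open import Relation.Binary.Definitions using (DecidableEquality)
open import Relation.Binary.PropositionalEquality
open import Relation.Nullary using (¬_; Dec; yes; no; does)
open import Relation.Nullary.Decidable using (True; toWitness; _×-dec_; _⊎-dec_)

module Walks (G : Graph) where

  data Walk : V G → V G → Set where
    done : ∀ {u w} → u ≡ w → Walk u w
    step : ∀ {u v w} (e : E G) → Joins G e u v → Walk v w → Walk u w

  walkLength : ∀ {u w} → Walk u w → ℕ
  walkLength (done _)     = 0
  walkLength (step _ _ p) = suc (walkLength p)

  vertex : ∀ {u w} (p : Walk u w) → Fin (suc (walkLength p)) → V G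
  vertex {u} (done _)     zero    = u
  vertex {u} (step _ _ _) zero    = u
  vertex     (step _ _ p) (suc i) = vertex p i

  edgeAt : ∀ {u w} (p : Walk u w) → Fin (walkLength p) → E G
  edgeAt (step e _ _) zero    = e
  edgeAt (step _ _ p) (suc i) = edgeAt p i

  vertex-zero : ∀ {u w} (p : Walk u w) → vertex p zero ≡ u
  vertex-zero (done _)     = refl
  vertex-zero (step _ _ _) = refl

  vertex-last : ∀ {u w} (p : Walk u w) i → toℕ i ≡ walkLength p → vertex p i ≡ w
  vertex-last (done u≡w)   zero    _  = u≡w
  vertex-last (step _ _ p) (suc i) eq = vertex-last p i (suc-injective eq)

  edgeAt-joins : ∀ {u w} (p : Walk u w) i →
                 Joins G (edgeAt p i) (vertex p (inject₁ i)) (vertex p (suc i))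
  edgeAt-joins (step _ j p) zero    rewrite vertex-zero p = j
  edgeAt-joins (step _ _ p) (suc i) = edgeAt-joins p i

  _++_ : ∀ {u v w} → Walk u v → Walk v w → Walk u w
  done refl  ++ q = q
  step e j p ++ q = step e j (p ++ q)

  walkLength-++ : ∀ {u v w} (p : Walk u v) (q : Walk v w) →
                  walkLength (p ++ q) ≡ walkLength p + walkLength q
  walkLength-++ (done refl)  q = refl
  walkLength-++ (step _ _ p) q = cong suc (walkLength-++ p q)

  AllSteps : (E G → V G → Set) → ∀ {u w} → Walk u w → Set
  AllSteps P (done _)         = ⊤
  AllSteps P (step {u} e _ p) = P e u × AllSteps P p

  allSteps : ∀ {P u w} (p : Walk u w) → (∀ i → P (edgeAt p i) (vertex p (inject₁ i))) → AllSteps P p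
  allSteps (done _)     _ = tt
  allSteps (step _ _ p) h = h zero , allSteps p (h ∘ suc)

  AllSteps-++ : ∀ {P u v w} (p : Walk u v) (q : Walk v w) →
                AllSteps P (p ++ q) → AllSteps P p × AllSteps P q
  AllSteps-++ (done refl)  q h        = tt , h
  AllSteps-++ (step _ _ p) q (h , hs) = let (hp , hq) = AllSteps-++ p q hs in (h , hp) , hq

  Numbered : (V G → ℕ) → ℕ → ∀ {u w} → Walk u w → Set
  Numbered f off (done _)         = ⊤
  Numbered f off (step {u} _ _ p) = f u ≡ off × Numbered f (suc off) p

  numbered-vertex : ∀ {f off u w} (p : Walk u w) → Numbered f off p →
                    ∀ i → f (vertex p (inject₁ i)) ≡ off + toℕ i
  numbered-vertex {off = off} (step _ _ p) (h , _)  zero    = trans h (sym (+-identityʳ off))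
  numbered-vertex {off = off} (step _ _ p) (_ , hs) (suc i) =
    trans (numbered-vertex p hs i) (sym (+-suc off (toℕ i)))

  numbered-++ : ∀ {f off u v w} (p : Walk u v) (q : Walk v w) →
                Numbered f off p → Numbered f (off + walkLength p) q → Numbered f off (p ++ q)
  numbered-++ {f} {off} (done refl)  q _        hq =
    subst (λ o → Numbered f o q) (+-identityʳ off) hq
  numbered-++ {f} {off} (step _ _ p) q (h , hp) hq =
    h , numbered-++ p q hp (subst (λ o → Numbered f o q) (+-suc off (walkLength p)) hq)

  csuc-cases : ∀ {m} (i : Fin m) →
               toℕ (csuc i) ≡ suc (toℕ i) ⊎ (suc (toℕ i) ≡ m × toℕ (csuc i) ≡ 0)
  csuc-cases {suc m} i with suc (toℕ i) <? suc m
  ... | yes lt = inj₁ (trans (toℕ-fromℕ< _) (m<n⇒m%n≡m lt))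
  ... | no ¬lt = inj₂ (last , trans (toℕ-fromℕ< _) (trans (cong (_% suc m) last) (n%n≡0 (suc m))))
    where
    last : suc (toℕ i) ≡ suc m
    last = ≤-antisym (toℕ<n i) (≮⇒≥ ¬lt)

  closed-successor : ∀ {u} (p : Walk u u) i → vertex p (suc i) ≡ vertex p (inject₁ (csuc i))
  closed-successor p i with csuc-cases i
  ... | inj₁ next = cong (vertex p) (toℕ-injective (sym (trans (toℕ-inject₁ (csuc i)) next)))
  ... | inj₂ (last , first) =
    trans (vertex-last p (suc i) last)
          (sym (trans (cong (vertex p) (toℕ-injective (trans (toℕ-inject₁ (csuc i)) first)))
                      (vertex-zero p)))

  closedWalk→Cycle : ∀ {u} (p : Walk u u) → 3 ≤ walkLength p →
                     (f : V G → ℕ) → Numbered f 0 p → Cycle G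
  closedWalk→Cycle p long f numbered = record
    { len      = walkLength p
    ; len≥3    = long
    ; vert     = vertex p ∘ inject₁
    ; vert-inj = λ {i} {j} eq → toℕ-injective
        (trans (sym (numbered-vertex p numbered i)) (trans (cong f eq) (numbered-vertex p numbered j)))
    ; edge     = edgeAt p
    ; edge-ok  = λ i → subst (Joins G (edgeAt p i) _) (closed-successor p i) (edgeAt-joins p i)
    }

start : (G : Graph) → Orientation G → Bool → E G → V G
start G o false = tail G o
start G o true  = head G o

directed? : (G : Graph) → DecidableEquality (V G) → (o : Orientation G) (C : Cycle G) →
            Dec (DirectedCycle G o C)
directed? G _≟_ o C =
  all? (λ i → tail G o (edge C i) ≟ vert C i) ⊎-dec all? (λ i → head G o (edge C i) ≟ vert C i)

xor-cancelˡ : ∀ a b → a xor (a xor b) ≡ b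
xor-cancelˡ a b = trans (sym (xor-assoc a a b)) (cong (_xor b) (xor-same a))

xor-cancelʳ : ∀ a b → (a xor b) xor b ≡ a
xor-cancelʳ a b = trans (xor-assoc a b b) (trans (cong (a xor_) (xor-same b)) (xor-identityʳ a))

xor-not-cancelʳ : ∀ a b → (a xor not b) xor b ≡ not a
xor-not-cancelʳ a b = trans (xor-assoc a (not b) b) (trans (cong (a xor_) (xor-inverseˡ b)) (xor-comm a true))

bool-pigeonhole : (a b c : Bool) → a ≢ b → b ≢ c → c ≢ a → ⊥
bool-pigeonhole false false _     a≢b _   _   = a≢b refl
bool-pigeonhole true  true  _     a≢b _   _   = a≢b refl
bool-pigeonhole false true  false _   _   c≢a = c≢a refl
bool-pigeonhole true  false true  _   _   c≢a = c≢a refl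
bool-pigeonhole false true  true  _   b≢c _   = b≢c refl
bool-pigeonhole true  false false _   b≢c _   = b≢c refl

xor-≢-not : ∀ a b → a xor b ≢ a xor not b
xor-≢-not false b = not-¬ refl
xor-≢-not true  b = not-¬ refl

third-side : ∀ a b c → a xor (b xor (c xor false)) ≡ false → b ≡ a xor c
third-side false false false _ = refl
third-side false true  true  _ = refl
third-side true  true  false _ = refl
third-side true  false true  _ = refl
third-side false false true  ()
third-side false true  false ()
third-side true  false false ()
third-side true  true  true  ()

odd : ℕ → Bool
odd zero          = false
odd (suc zero)    = true
odd (suc (suc n)) = odd n

odd-suc : ∀ n → odd (suc n) ≡ not (odd n)
odd-suc zero          = refl
odd-suc (suc zero)    = refl
odd-suc (suc (suc n)) = odd-suc n

odd-+ : ∀ m n → odd (m + n) ≡ odd m xor odd n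
odd-+ zero          n = refl
odd-+ (suc zero)    n = odd-suc n
odd-+ (suc (suc m)) n = odd-+ m n

odd⇒Odd : ∀ n → odd n ≡ true → Odd n
odd⇒Odd (suc zero)    _ = one
odd⇒Odd (suc (suc n)) h = ss (odd⇒Odd n h)

module Xor = CommutativeSemigroupProperties (CommutativeRing.+-commutativeSemigroup xor-∧-commutativeRing)

weight : ∀ {m} → (Fin m → Bool) → Vec Bool m → Bool
weight p []       = false
weight p (b ∷ bs) = (b ∧ p zero) xor weight (p ∘ suc) bs

weight-flip : ∀ {m} (p : Fin m → Bool) bs i → weight p (bs [ i ]%= not) ≡ p i xor weight p bs
weight-flip p (true  ∷ bs) zero    = sym (xor-cancelˡ (p zero) (weight (p ∘ suc) bs))
weight-flip p (false ∷ bs) zero    = refl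
weight-flip p (b     ∷ bs) (suc i) =
  trans (cong ((b ∧ p zero) xor_) (weight-flip (p ∘ suc) bs i)) (Xor.x∙yz≈y∙xz (b ∧ p zero) (p (suc i)) (weight (p ∘ suc) bs))

weight-xor : ∀ {m} (p : Fin m → Bool) (us vs : Vec Bool m) →
             weight p (zipWith _xor_ us vs) ≡ weight p us xor weight p vs
weight-xor p []       []       = refl
weight-xor p (u ∷ us) (v ∷ vs) =
  trans (cong₂ _xor_ (∧-distribʳ-xor (p zero) u v) (weight-xor (p ∘ suc) us vs))
        (Xor.interchange (u ∧ p zero) (v ∧ p zero) (weight (p ∘ suc) us) (weight (p ∘ suc) vs))

pattern E01 = zero
pattern E02 = suc zero
pattern E03 = suc (suc zero)
pattern E12 = suc (suc (suc zero))
pattern E13 = suc (suc (suc (suc zero)))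
pattern E23 = suc (suc (suc (suc (suc zero))))

stepFrom stepTo : Fin 6 → Bool → Fin 4
stepFrom e true  = proj₁ (K4ends e)
stepFrom e false = proj₂ (K4ends e)
stepTo e true  = proj₂ (K4ends e)
stepTo e false = proj₁ (K4ends e)

data K4Walk : Fin 4 → Fin 4 → Set where
  kdone : ∀ {a} → K4Walk a a
  kstep : ∀ {b} (e : Fin 6) (s : Bool) → K4Walk (stepTo e s) b → K4Walk (stepFrom e s) b

steps : ∀ {a b} → K4Walk a b → List (Fin 6 × Bool)
steps kdone         = []
steps (kstep e s r) = (e , s) ∷ steps r

edgeSet : ∀ {a b} → K4Walk a b → Vec Bool 6
edgeSet kdone         = replicate 6 false
edgeSet (kstep e s r) = edgeSet r [ e ]%= not

-- x e is the direction of the path replacing e (true: from its first end to its second);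
-- away x v e says that it leaves its end v, and a step along e enters v iff its sense is towards v e.
towards : Fin 4 → Fin 6 → Bool
towards v e = does (v ≟ᶠ proj₂ (K4ends e))

away : (Fin 6 → Bool) → Fin 4 → Fin 6 → Bool
away x v e = x e xor towards v e

Passes : Fin 4 → Fin 6 → Fin 6 → List (Fin 6 × Bool) → Set
Passes v e e′ xs = ((e , towards v e) ∈ xs × (e′ , not (towards v e′)) ∈ xs)
                 ⊎ ((e′ , towards v e′) ∈ xs × (e , not (towards v e)) ∈ xs)

passes? : ∀ v e e′ xs → Dec (Passes v e e′ xs)
passes? v e e′ xs = (_ ∈? xs ×-dec _ ∈? xs) ⊎-dec (_ ∈? xs ×-dec _ ∈? xs)
  where open import Data.List.Membership.DecPropositional (Product.≡-dec _≟ᶠ_ _≟ᵇ_) using (_∈?_)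

Consistent : (Fin 6 → Bool) → Bool → List (Fin 6 × Bool) → Set
Consistent x c = All (λ (e , s) → x e ≡ c xor s)

consistent-away : ∀ {x c xs} v e e′ → Consistent x c xs → Passes v e e′ xs → away x v e ≢ away x v e′
consistent-away {c = c} v e e′ cons (inj₁ (enter , leave)) =
  entered≢left (lookup cons enter) (lookup cons leave)
  where
  entered≢left : ∀ {a a′ t t′} → a ≡ c xor t → a′ ≡ c xor not t′ → a xor t ≢ a′ xor t′
  entered≢left {t = t} {t′} refl refl eq =
    not-¬ refl (trans (sym (xor-cancelʳ c t)) (trans eq (xor-not-cancelʳ c t′)))
consistent-away {c = c} v e e′ cons (inj₂ (enter , leave)) =
  consistent-away {c = c} v e′ e cons (inj₁ (enter , leave)) ∘ sym

module Subdivision (k : Fin 6 → ℕ) where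

  H : Graph
  H = SubdivK4 k

  open Walks H

  pathLength : Fin 6 → ℕ
  pathLength e = suc (k e)

  pos : Fin 6 → ℕ → SubV k
  pos = pathPos k

  pathEdge : (e : Fin 6) (t : ℕ) → t < pathLength e → E H
  pathEdge e t lt = e , fromℕ< lt

  pathEdge-ends : ∀ e t lt → ends H (pathEdge e t lt) ≡ (pos e t , pos e (suc t))
  pathEdge-ends e t lt = cong₂ (λ a b → pos e a , pos e b) (toℕ-fromℕ< lt) (cong suc (toℕ-fromℕ< lt))

  pos-last : ∀ e → pos e (pathLength e) ≡ inj₁ (proj₂ (K4ends e))
  pos-last e with k e <? k e
  ... | yes lt = ⊥-elim (<-irrefl refl lt)
  ... | no _   = refl

  pos-one≢pos-zero : ∀ e → pos e 1 ≢ pos e 0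
  pos-one≢pos-zero e eq with 0 <? k e
  pos-one≢pos-zero e   () | yes _
  pos-one≢pos-zero E01 () | no _
  pos-one≢pos-zero E02 () | no _
  pos-one≢pos-zero E03 () | no _
  pos-one≢pos-zero E12 () | no _
  pos-one≢pos-zero E13 () | no _
  pos-one≢pos-zero E23 () | no _

  forwardPath : (e : Fin 6) (t d : ℕ) → d + t ≡ pathLength e → Walk (pos e t) (inj₁ (proj₂ (K4ends e)))
  forwardPath e t zero    refl = done (pos-last e)
  forwardPath e t (suc d) eq   =
    step (pathEdge e t lt) (inj₁ (pathEdge-ends e t lt)) (forwardPath e (suc t) d (trans (+-suc d t) eq))
    where
    lt : t < pathLength e
    lt = subst (suc t ≤_) eq (s≤s (m≤n+m t d))

  backwardPath : (e : Fin 6) (m : ℕ) → m ≤ pathLength e → ∀ {u} → u ≡ pos e m →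
                 Walk u (inj₁ (proj₁ (K4ends e)))
  backwardPath e zero    _  u≡ = done u≡
  backwardPath e (suc m) le u≡ =
    step (pathEdge e m le) (inj₂ (trans (pathEdge-ends e m le) (cong (pos e m ,_) (sym u≡))))
         (backwardPath e m (≤-trans (n≤1+n m) le) refl)

  segment : (e : Fin 6) (s : Bool) → Walk (inj₁ (stepFrom e s)) (inj₁ (stepTo e s))
  segment e true  = forwardPath e 0 (pathLength e) (+-identityʳ _)
  segment e false = backwardPath e (pathLength e) ≤-refl (sym (pos-last e))

  subdivide : ∀ {a b} → K4Walk a b → Walk (inj₁ a) (inj₁ b)
  subdivide kdone         = done refl
  subdivide (kstep e s r) = segment e s ++ subdivide r

  subdividedLength : ∀ {a b} → K4Walk a b → ℕ
  subdividedLength kdone         = 0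
  subdividedLength (kstep e s r) = pathLength e + subdividedLength r

  walkLength-forwardPath : ∀ e t d eq → walkLength (forwardPath e t d eq) ≡ d
  walkLength-forwardPath e t zero    refl = refl
  walkLength-forwardPath e t (suc d) eq   = cong suc (walkLength-forwardPath e (suc t) d _)

  walkLength-backwardPath : ∀ e m le {u} (u≡ : u ≡ pos e m) → walkLength (backwardPath e m le u≡) ≡ m
  walkLength-backwardPath e zero    _ _ = refl
  walkLength-backwardPath e (suc m) _ _ = cong suc (walkLength-backwardPath e m _ refl)

  walkLength-segment : ∀ e s → walkLength (segment e s) ≡ pathLength e
  walkLength-segment e true  = walkLength-forwardPath e 0 (pathLength e) _
  walkLength-segment e false = walkLength-backwardPath e (pathLength e) ≤-refl (sym (pos-last e))

  walkLength-subdivide : ∀ {a b} (kw : K4Walk a b) → walkLength (subdivide kw) ≡ subdividedLength kw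
  walkLength-subdivide kdone         = refl
  walkLength-subdivide (kstep e s r) =
    trans (walkLength-++ (segment e s) (subdivide r)) (cong₂ _+_ (walkLength-segment e s) (walkLength-subdivide r))

  length-steps≤subdividedLength : ∀ {a b} (kw : K4Walk a b) → length (steps kw) ≤ subdividedLength kw
  length-steps≤subdividedLength kdone         = z≤n
  length-steps≤subdividedLength (kstep e s r) = s≤s (≤-trans (length-steps≤subdividedLength r) (m≤n+m _ (k e)))

  pathParity : Fin 6 → Bool
  pathParity = odd ∘ pathLength

  odd-subdividedLength : ∀ {a b} (kw : K4Walk a b) → odd (subdividedLength kw) ≡ weight pathParity (edgeSet kw)
  odd-subdividedLength kdone         = refl
  odd-subdividedLength (kstep e s r) =
    trans (odd-+ (pathLength e) (subdividedLength r))
          (trans (cong (pathParity e xor_) (odd-subdividedLength r)) (sym (weight-flip pathParity (edgeSet r) e)))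

  segmentLabel : Bool → ℕ → (e : Fin 6) → Fin (k e) → ℕ
  segmentLabel true  off e j = off + suc (toℕ j)
  segmentLabel false off e j = (off + pathLength e) ∸ suc (toℕ j)

  -- The position of each vertex along subdivide kw, chosen so that Labelled holds by computation
  -- for every concrete cycle of K₄.
  label : ∀ {a b} → K4Walk a b → ℕ → SubV k → ℕ
  label kdone         off _        = 0
  label (kstep e s r) off (inj₁ v) =
    if does (v ≟ᶠ stepFrom e s) then off else label r (off + pathLength e) (inj₁ v)
  label (kstep e s r) off (inj₂ (e′ , j)) with e′ ≟ᶠ e
  ... | yes refl = segmentLabel s off e j
  ... | no _     = label r (off + pathLength e) (inj₂ (e′ , j))

  SegmentLabelled : (SubV k → ℕ) → Fin 6 → Bool → ℕ → Set
  SegmentLabelled f e s off =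
    f (inj₁ (stepFrom e s)) ≡ off × (∀ j → f (inj₂ (e , j)) ≡ segmentLabel s off e j)

  Labelled : (SubV k → ℕ) → ∀ {a b} → K4Walk a b → ℕ → Set
  Labelled f kdone         off = ⊤
  Labelled f (kstep e s r) off = SegmentLabelled f e s off × Labelled f r (off + pathLength e)

  backward-label-sum : ∀ off e (j : Fin (k e)) → segmentLabel false off e j + suc (toℕ j) ≡ off + pathLength e
  backward-label-sum off e j = m∸n+n≡m (≤-trans (s≤s (<⇒≤ (toℕ<n j))) (m≤n+m (pathLength e) off))

  forward-numbered : ∀ f e base → (∀ t → t < pathLength e → f (pos e t) ≡ base + t) →
                     ∀ t d eq off → off ≡ base + t → Numbered f off (forwardPath e t d eq)
  forward-numbered f e base h t zero    refl off _ = tt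
  forward-numbered f e base h t (suc d) eq   off o =
    trans (h t (subst (suc t ≤_) eq (s≤s (m≤n+m t d)))) (sym o) ,
    forward-numbered f e base h (suc t) d _ (suc off) (trans (cong suc o) (sym (+-suc base t)))

  backward-numbered : ∀ f e top → (∀ t → 0 < t → t ≤ pathLength e → f (pos e t) + t ≡ top) →
                      ∀ m le {u} (u≡ : u ≡ pos e m) off → off + m ≡ top →
                      Numbered f off (backwardPath e m le u≡)
  backward-numbered f e top h zero    le     u≡ off o = tt
  backward-numbered f e top h (suc m) le {u} u≡ off o =
    +-cancelʳ-≡ (suc m) (f u) off
      (trans (cong (λ x → f x + suc m) u≡) (trans (h (suc m) (s≤s z≤n) le) (sym o))) ,
    backward-numbered f e top h m _ refl (suc off) (trans (sym (+-suc off m)) o)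

  segment-numbered : ∀ f e s off → SegmentLabelled f e s off → Numbered f off (segment e s)
  segment-numbered f e true off (h₀ , hᵢ) =
    forward-numbered f e off position 0 (pathLength e) _ off (sym (+-identityʳ off))
    where
    position : ∀ t → t < pathLength e → f (pos e t) ≡ off + t
    position zero    _  = trans h₀ (sym (+-identityʳ off))
    position (suc t) lt with t <? k e
    ... | yes p = trans (hᵢ (fromℕ< p)) (cong (λ x → off + suc x) (toℕ-fromℕ< p))
    ... | no ¬p = ⊥-elim (¬p (≤-pred lt))
  segment-numbered f e false off (h₀ , hᵢ) =
    backward-numbered f e (off + pathLength e) position (pathLength e) ≤-refl (sym (pos-last e)) off refl
    where
    position : ∀ t → 0 < t → t ≤ pathLength e → f (pos e t) + t ≡ off + pathLength e
    position (suc t) _ le with t <? k e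
    ... | yes p = trans (cong (λ x → f (inj₂ (e , fromℕ< p)) + suc x) (sym (toℕ-fromℕ< p)))
                        (trans (cong (_+ suc (toℕ (fromℕ< p))) (hᵢ (fromℕ< p))) (backward-label-sum off e (fromℕ< p)))
    ... | no ¬p = cong₂ _+_ h₀ (cong suc (≤-antisym (≤-pred le) (≮⇒≥ ¬p)))

  subdivide-numbered : ∀ f {a b} (kw : K4Walk a b) off → Labelled f kw off → Numbered f off (subdivide kw)
  subdivide-numbered f kdone         off _        = tt
  subdivide-numbered f (kstep e s r) off (h , hs) =
    numbered-++ (segment e s) (subdivide r) (segment-numbered f e s off h)
      (subst (λ o → Numbered f o (subdivide r)) (cong (off +_) (sym (walkLength-segment e s)))
             (subdivide-numbered f r (off + pathLength e) hs))

record K4Cycle : Set where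
  field
    base     : Fin 4
    walk     : K4Walk base base
    long     : 3 ≤ length (steps walk)
    labelled : ∀ k → Subdivision.Labelled k (Subdivision.label k walk 0) walk 0
open K4Cycle

triangle012 triangle013 triangle023 triangle123 : K4Cycle
triangle012 = record
  { walk = kstep E01 true (kstep E12 true (kstep E02 false kdone)) ; long = ≤-refl
  ; labelled = λ _ → (refl , λ _ → refl) , (refl , λ _ → refl) , (refl , λ _ → refl) , tt }
triangle013 = record
  { walk = kstep E01 true (kstep E13 true (kstep E03 false kdone)) ; long = ≤-refl
  ; labelled = λ _ → (refl , λ _ → refl) , (refl , λ _ → refl) , (refl , λ _ → refl) , tt }
triangle023 = record
  { walk = kstep E02 true (kstep E23 true (kstep E03 false kdone)) ; long = ≤-refl
  ; labelled = λ _ → (refl , λ _ → refl) , (refl , λ _ → refl) , (refl , λ _ → refl) , tt }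
triangle123 = record
  { walk = kstep E12 true (kstep E23 true (kstep E13 false kdone)) ; long = ≤-refl
  ; labelled = λ _ → (refl , λ _ → refl) , (refl , λ _ → refl) , (refl , λ _ → refl) , tt }

square0123 square0132 square0213 : K4Cycle
square0123 = record
  { walk = kstep E01 true (kstep E12 true (kstep E23 true (kstep E03 false kdone))) ; long = n≤1+n 3
  ; labelled = λ _ → (refl , λ _ → refl) , (refl , λ _ → refl) , (refl , λ _ → refl) , (refl , λ _ → refl) , tt }
square0132 = record
  { walk = kstep E01 true (kstep E13 true (kstep E23 false (kstep E02 false kdone))) ; long = n≤1+n 3
  ; labelled = λ _ → (refl , λ _ → refl) , (refl , λ _ → refl) , (refl , λ _ → refl) , (refl , λ _ → refl) , tt }
square0213 = record
  { walk = kstep E02 true (kstep E12 false (kstep E13 true (kstep E03 false kdone))) ; long = n≤1+n 3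
  ; labelled = λ _ → (refl , λ _ → refl) , (refl , λ _ → refl) , (refl , λ _ → refl) , (refl , λ _ → refl) , tt }

record Fan (v : Fin 4) (e e′ : Fin 6) (opposite : K4Cycle) : Set where
  constructor fan
  field
    triangle square  : K4Cycle
    triangle-passes  : True (passes? v e e′ (steps (walk triangle)))
    square-passes    : True (passes? v e e′ (steps (walk square)))
    triangle⊕square : zipWith _xor_ (edgeSet (walk triangle)) (edgeSet (walk square)) ≡ edgeSet (walk opposite)
open Fan

record Star : Set where
  field
    centre   : Fin 4
    opposite : K4Cycle
    spoke₁ spoke₂ spoke₃ : Fin 6
    fan₁₂ : Fan centre spoke₁ spoke₂ opposite
    fan₂₃ : Fan centre spoke₂ spoke₃ opposite
    fan₃₁ : Fan centre spoke₃ spoke₁ opposite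
open Star

star₁ star₂ star₃ : Star
star₁ = record
  { centre = suc zero ; opposite = triangle023 ; spoke₁ = E01 ; spoke₂ = E12 ; spoke₃ = E13
  ; fan₁₂ = fan triangle012 square0123 _ _ refl
  ; fan₂₃ = fan triangle123 square0213 _ _ refl
  ; fan₃₁ = fan triangle013 square0132 _ _ refl }
star₂ = record
  { centre = suc (suc zero) ; opposite = triangle013 ; spoke₁ = E02 ; spoke₂ = E12 ; spoke₃ = E23
  ; fan₁₂ = fan triangle012 square0213 _ _ refl
  ; fan₂₃ = fan triangle123 square0123 _ _ refl
  ; fan₃₁ = fan triangle023 square0132 _ _ refl }
star₃ = record
  { centre = suc (suc (suc zero)) ; opposite = triangle012 ; spoke₁ = E03 ; spoke₂ = E13 ; spoke₃ = E23
  ; fan₁₂ = fan triangle013 square0213 _ _ refl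
  ; fan₂₃ = fan triangle123 square0132 _ _ refl
  ; fan₃₁ = fan triangle023 square0123 _ _ refl }

module _ (k : Fin 6 → ℕ) where
  open Subdivision k
  open Walks H

  cycleOf : K4Cycle → Cycle H
  cycleOf C = closedWalk→Cycle (subdivide (walk C))
    (≤-trans (long C) (subst (length (steps (walk C)) ≤_) (sym (walkLength-subdivide (walk C)))
                             (length-steps≤subdividedLength (walk C))))
    (label (walk C) 0) (subdivide-numbered _ (walk C) 0 (labelled C k))

  isOdd : K4Cycle → Bool
  isOdd C = odd (subdividedLength (walk C))

  Odd-cycleOf : ∀ C → isOdd C ≡ true → Odd (len (cycleOf C))
  Odd-cycleOf C h = odd⇒Odd _ (trans (cong odd (walkLength-subdivide (walk C))) h)

  isOdd-⊕ : ∀ A B C → zipWith _xor_ (edgeSet (walk A)) (edgeSet (walk B)) ≡ edgeSet (walk C) →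
            isOdd C ≡ isOdd A xor isOdd B
  isOdd-⊕ A B C A⊕B≡C = begin
    isOdd C                                                      ≡⟨ odd-subdividedLength (walk C) ⟩
    weight pathParity (edgeSet (walk C))                         ≡⟨ cong (weight pathParity) A⊕B≡C ⟨
    weight pathParity (zipWith _xor_ (edgeSet (walk A)) (edgeSet (walk B)))
      ≡⟨ weight-xor pathParity (edgeSet (walk A)) (edgeSet (walk B)) ⟩
    weight pathParity (edgeSet (walk A)) xor weight pathParity (edgeSet (walk B))
      ≡⟨ cong₂ _xor_ (odd-subdividedLength (walk A)) (odd-subdividedLength (walk B)) ⟨
    isOdd A xor isOdd B                                          ∎
    where open ≡-Reasoning

  vertexColour : Fin 4 → Bool
  vertexColour zero                   = false
  vertexColour (suc zero)             = pathParity E01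
  vertexColour (suc (suc zero))       = pathParity E02
  vertexColour (suc (suc (suc zero))) = pathParity E03

  colour : SubV k → Bool
  colour (inj₁ v)       = vertexColour v
  colour (inj₂ (e , j)) = vertexColour (proj₁ (K4ends e)) xor odd (suc (toℕ j))

  evenTriangles⇒Bipartite : isOdd triangle012 ≡ false → isOdd triangle013 ≡ false → isOdd triangle023 ≡ false →
                            Bipartite H
  evenTriangles⇒Bipartite even₀₁₂ even₀₁₃ even₀₂₃ = colour , proper
    where
    weight-even : ∀ C → isOdd C ≡ false → weight pathParity (edgeSet (walk C)) ≡ false
    weight-even C = trans (sym (odd-subdividedLength (walk C)))

    end-colour : ∀ e → vertexColour (proj₂ (K4ends e)) ≡ vertexColour (proj₁ (K4ends e)) xor pathParity e
    end-colour E01 = refl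
    end-colour E02 = refl
    end-colour E03 = refl
    end-colour E12 = third-side (pathParity E01) (pathParity E02) (pathParity E12) (weight-even triangle012 even₀₁₂)
    end-colour E13 = third-side (pathParity E01) (pathParity E03) (pathParity E13) (weight-even triangle013 even₀₁₃)
    end-colour E23 = third-side (pathParity E02) (pathParity E03) (pathParity E23) (weight-even triangle023 even₀₂₃)

    colour-pos : ∀ e t → t ≤ pathLength e → colour (pos e t) ≡ vertexColour (proj₁ (K4ends e)) xor odd t
    colour-pos e zero    _  = sym (xor-identityʳ _)
    colour-pos e (suc t) le with t <? k e
    ... | yes p = cong (λ x → vertexColour (proj₁ (K4ends e)) xor odd (suc x)) (toℕ-fromℕ< p)
    ... | no ¬p = trans (end-colour e)
        (cong (λ x → vertexColour (proj₁ (K4ends e)) xor odd (suc x)) (sym (≤-antisym (≤-pred le) (≮⇒≥ ¬p))))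

    proper : ∀ ed → colour (proj₁ (ends H ed)) ≢ colour (proj₂ (ends H ed))
    proper (e , j) eq = xor-≢-not (vertexColour (proj₁ (K4ends e))) (odd (toℕ j))
      (trans (sym (colour-pos e (toℕ j) (<⇒≤ (toℕ<n j))))
      (trans eq (trans (colour-pos e (suc (toℕ j)) (toℕ<n j))
                       (cong (vertexColour (proj₁ (K4ends e)) xor_) (odd-suc (toℕ j))))))

  oddOppositeStar : ¬ Bipartite H → Σ Star λ S → isOdd (opposite S) ≡ true
  oddOppositeStar nonBipartite
    with isOdd triangle023 in odd₀₂₃ | isOdd triangle013 in odd₀₁₃ | isOdd triangle012 in odd₀₁₂
  ... | true  | _     | _     = star₁ , odd₀₂₃
  ... | false | true  | _     = star₂ , odd₀₁₃
  ... | false | false | true  = star₃ , odd₀₁₂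
  ... | false | false | false = ⊥-elim (nonBipartite (evenTriangles⇒Bipartite odd₀₁₂ odd₀₁₃ odd₀₂₃))

module _ (k : Fin 6 → ℕ) (o : Orientation (SubdivK4 k)) where
  open Subdivision k
  open Walks H

  OddInconsistentCycle : Set
  OddInconsistentCycle = Σ (Cycle H) λ C → Odd (len C) × Inconsistent H o C

  -- A directed cycle orients all edges of a path alike, so the first edge stands for the path.
  pathDirection : Fin 6 → Bool
  pathDirection e = o (e , zero)

  Starts : Bool → E H → V H → Set
  Starts c ed u = start H o c ed ≡ u

  first-edge-direction : ∀ e c s → start H o c (e , zero) ≡ pos e (if s then 0 else 1) → o (e , zero) ≡ c xor s
  first-edge-direction e false true  h with o (e , zero)
  ... | true  = refl
  ... | false = ⊥-elim (pos-one≢pos-zero e h)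
  first-edge-direction e false false h with o (e , zero)
  ... | true  = ⊥-elim (pos-one≢pos-zero e (sym h))
  ... | false = refl
  first-edge-direction e true  true  h with o (e , zero)
  ... | true  = ⊥-elim (pos-one≢pos-zero e h)
  ... | false = refl
  first-edge-direction e true  false h with o (e , zero)
  ... | true  = refl
  ... | false = ⊥-elim (pos-one≢pos-zero e (sym h))

  backwardPath-last : ∀ {P} e m le {u} (u≡ : u ≡ pos e (suc m)) →
                      AllSteps P (backwardPath e (suc m) le u≡) → P (e , zero) (pos e 1)
  backwardPath-last {P} e zero    _ u≡ (h , _) = subst (P (e , zero)) u≡ h
  backwardPath-last     e (suc m) _ _  (_ , h) = backwardPath-last e m _ refl h

  segment-direction : ∀ {c} e s → AllSteps (Starts c) (segment e s) → pathDirection e ≡ c xor s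
  segment-direction {c} e true  (h , _) = first-edge-direction e c true h
  segment-direction {c} e false h       =
    first-edge-direction e c false (backwardPath-last e (k e) ≤-refl (sym (pos-last e)) h)

  subdivide-consistent : ∀ {c a b} (kw : K4Walk a b) → AllSteps (Starts c) (subdivide kw) →
                         Consistent pathDirection c (steps kw)
  subdivide-consistent         kdone         _ = []
  subdivide-consistent {c} (kstep e s r) h =
    let (h₁ , h₂) = AllSteps-++ (segment e s) (subdivide r) h
    in segment-direction {c} e s h₁ ∷ subdivide-consistent {c} r h₂

  directed⇒consistent : ∀ C → DirectedCycle H o (cycleOf k C) → Σ Bool λ c → Consistent pathDirection c (steps (walk C))
  directed⇒consistent C (inj₁ forwards)  =
    false , subdivide-consistent {false} (walk C) (allSteps {Starts false} (subdivide (walk C)) forwards)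
  directed⇒consistent C (inj₂ backwards) =
    true  , subdivide-consistent {true} (walk C) (allSteps {Starts true} (subdivide (walk C)) backwards)

  _≟ᵛ_ : DecidableEquality (SubV k)
  _≟ᵛ_ = Sum.≡-dec _≟ᶠ_ (Product.≡-dec _≟ᶠ_ _≟ᶠ_)

  inconsistent-or-consistent : ∀ C → isOdd k C ≡ true →
                               OddInconsistentCycle ⊎ Σ Bool λ c → Consistent pathDirection c (steps (walk C))
  inconsistent-or-consistent C odd with directed? H _≟ᵛ_ o (cycleOf k C)
  ... | no  ¬directed = inj₁ (cycleOf k C , Odd-cycleOf k C odd , ¬directed)
  ... | yes directed  = inj₂ (directed⇒consistent C directed)

  passing-cycle : ∀ {v e e′} C → isOdd k C ≡ true → True (passes? v e e′ (steps (walk C))) →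
                  OddInconsistentCycle ⊎ away pathDirection v e ≢ away pathDirection v e′
  passing-cycle {v} {e} {e′} C odd passes with inconsistent-or-consistent C odd
  ... | inj₁ found      = inj₁ found
  ... | inj₂ (c , cons) = inj₂ (consistent-away {c = c} v e e′ cons (toWitness passes))

  fan-away : ∀ {v e e′ opposite} → Fan v e e′ opposite → isOdd k opposite ≡ true →
             OddInconsistentCycle ⊎ away pathDirection v e ≢ away pathDirection v e′
  fan-away {v} {e} {e′} {opposite} F oddOpposite with isOdd k (triangle F) in oddTriangle
  ... | true  = passing-cycle {v} {e} {e′} (triangle F) oddTriangle (triangle-passes F)
  ... | false = passing-cycle {v} {e} {e′} (square F) oddSquare (square-passes F)
    where
    oddSquare : isOdd k (square F) ≡ true
    oddSquare = trans (cong (_xor isOdd k (square F)) (sym oddTriangle))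
                      (trans (sym (isOdd-⊕ k (triangle F) (square F) opposite (triangle⊕square F))) oddOpposite)

  star-argument : (S : Star) → isOdd k (opposite S) ≡ true → OddInconsistentCycle
  star-argument S odd with fan-away (fan₁₂ S) odd | fan-away (fan₂₃ S) odd | fan-away (fan₃₁ S) odd
  ... | inj₁ found | _          | _          = found
  ... | inj₂ _     | inj₁ found | _          = found
  ... | inj₂ _     | inj₂ _     | inj₁ found = found
  ... | inj₂ d₁₂   | inj₂ d₂₃   | inj₂ d₃₁   = ⊥-elim (bool-pigeonhole _ _ _ d₁₂ d₂₃ d₃₁)

lemma5p1 : (k : Fin 6 → ℕ) → ¬ Bipartite (SubdivK4 k) →
    (o : Orientation (SubdivK4 k)) →
    Σ (Cycle (SubdivK4 k)) (λ C → Odd (len C) × Inconsistent (SubdivK4 k) o C)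
lemma5p1 k nonBipartite o =
  let (S , oddOpposite) = oddOppositeStar k nonBipartite
  in star-argument k o S oddOpposite
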